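{- Let $G=(V,E)$ be a finite simple graph with $E=\{e_1,\dots,e_m\}$, and let $T$ be its Hashimoto matrix on $\mathbb R^{\vec E}$ ($\vec E$ the $2m$ directed edges), $T_{(u,v),(x,y)}=1$ if $v=x$ and $y\neq u$, else $0$. Fix a reference orientation of each edge $e$, write $e^+$ for the directed edge in the reference direction and $e^-$ for its reverse, and set \[\phi_e^\pm=\tfrac1{\sqrt2}(\mathbf e_{e^+}\pm\mathbf e_{e^- }).\] Let $Q$ be the orthogonal $2m\times 2m$ matrix whose columns are $\phi_{e_1}^+,\dots,\phi_{e_m}^+,\phi_{e_1}^-,\dots,\phi_{e_m}^-$. Let $D$ be the oriented incidence matrix ($D_{v,e}=+1$ if $v$ is the head of $e$ under the reference orientation, $-1$ if $v$ is its tail, $0$ otherwise), $|D|$ its entrywise absolute value, $L=|D|^\top|D|-2I$ and $S=D^\top D-2I$ ($I$ the $m\times m$ identity). Then \[Q^\top TQ=\begin{pmatrix}\tfrac12 L & -\tfrac12|D|^\top D\\[2pt] \tfrac12 D^\top|D| & -\tfrac12 S\end{pmatrix}.\] Equivalently, the compression of $T$ to the $+1$-eigenspace of edge reversal is $\tfrac12L$, to the $-1$-eigenspace is $-\tfrac12S$, and the cross-couplings are the mixed incidence products shown.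
   Context: $L$ is the adjacency matrix of the line graph of $G$ and $S$ is the signed adjacency matrix of the antisymmetric line graph of $G$. Edge reversal is the involution $(u,v)\mapsto(v,u)$ on directed edges; $\phi_e^\pm$ are its $\pm1$ eigenvectors. -}

module Defs where

open import Level using (Level)
open import Data.Nat using (ℕ; zero; suc)
open import Data.Fin using (Fin; zero; suc)
open import Data.Fin.Properties using (_≟_)
open import Data.Sum using (_⊎_; inj₁; inj₂)
open import Data.Product using (_×_; _,_)
open import Relation.Nullary using (¬_; yes; no)
open import Relation.Binary.PropositionalEquality using (_≡_; _≢_)
open import Algebra.Bundles using (CommutativeRing)

record SimpleGraph (n m : ℕ) : Set where
  field
    tail head : Fin m → Fin n
    noLoop    : ∀ e → tail e ≢ head e
    noMulti   : ∀ e f → e ≢ f →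
                ¬ (tail e ≡ tail f × head e ≡ head f) ×
                ¬ (tail e ≡ head f × head e ≡ tail f)

-- Directed edges: inj₁ e = e⁺ (reference direction), inj₂ e = e⁻ (reverse).
Dart : ℕ → Set
Dart m = Fin m ⊎ Fin m

module _ {n m : ℕ} (G : SimpleGraph n m) where
  open SimpleGraph G

  dartTail : Dart m → Fin n
  dartTail (inj₁ e) = tail e
  dartTail (inj₂ e) = head e

  dartHead : Dart m → Fin n
  dartHead (inj₁ e) = head e
  dartHead (inj₂ e) = tail e

module _ {c ℓ : Level} (R : CommutativeRing c ℓ) where
  open CommutativeRing R using (Carrier; _+_; _*_; -_; _-_; 0#; 1#)

  Σ[_] : (k : ℕ) → (Fin k → Carrier) → Carrier
  Σ[ zero ] f = 0#
  Σ[ suc k ] f = f zero + Σ[ k ] (λ i → f (suc i))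

  Σ⊎ : (k : ℕ) → (Dart k → Carrier) → Carrier
  Σ⊎ k f = Σ[ k ] (λ i → f (inj₁ i)) + Σ[ k ] (λ i → f (inj₂ i))

  -- Matrices are functions  rows → cols → Carrier.
  transpose : {A B : Set} → (A → B → Carrier) → B → A → Carrier
  transpose M b a = M a b

  mulFin : {A B : Set} (k : ℕ) → (A → Fin k → Carrier) → (Fin k → B → Carrier) → A → B → Carrier
  mulFin k M N a b = Σ[ k ] (λ i → M a i * N i b)

  mulDart : {A B : Set} (k : ℕ) → (A → Dart k → Carrier) → (Dart k → B → Carrier) → A → B → Carrier
  mulDart k M N a b = Σ⊎ k (λ i → M a i * N i b)

  δ : {k : ℕ} → Fin k → Fin k → Carrier
  δ i j with i ≟ j
  ... | yes _ = 1#
  ... | no  _ = 0#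

  two : Carrier
  two = 1# + 1#

  module _ {n m : ℕ} (G : SimpleGraph n m) where
    open SimpleGraph G

    hashimoto : Dart m → Dart m → Carrier
    hashimoto d d' with dartHead G d ≟ dartTail G d' | dartHead G d' ≟ dartTail G d
    ... | yes _ | no _  = 1#
    ... | _     | _     = 0#

    incD : Fin n → Fin m → Carrier
    incD v e with v ≟ head e | v ≟ tail e
    ... | yes _ | _     = 1#
    ... | no _  | yes _ = - 1#
    ... | no _  | no _  = 0#

    absD : Fin n → Fin m → Carrier
    absD v e with v ≟ head e | v ≟ tail e
    ... | yes _ | _     = 1#
    ... | no _  | yes _ = 1#
    ... | no _  | no _  = 0#

    lineL : Fin m → Fin m → Carrier
    lineL e f = mulFin n (transpose absD) absD e f - two * δ e f

    signedS : Fin m → Fin m → Carrier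
    signedS e f = mulFin n (transpose incD) incD e f - two * δ e f

    -- Q, given r (= 1/√2): columns inj₁ e = φ_e⁺ = r(𝐞_{e⁺} + 𝐞_{e⁻}),
    --                      columns inj₂ e = φ_e⁻ = r(𝐞_{e⁺} - 𝐞_{e⁻}).
    Qmat : Carrier → Dart m → Dart m → Carrier
    Qmat r (inj₁ k) (inj₁ e) = r * δ k e
    Qmat r (inj₂ k) (inj₁ e) = r * δ k e
    Qmat r (inj₁ k) (inj₂ e) = r * δ k e
    Qmat r (inj₂ k) (inj₂ e) = - (r * δ k e)

    -- the claimed block matrix, with h playing the role of 1/2
    blockM : Carrier → Dart m → Dart m → Carrier
    blockM h (inj₁ e) (inj₁ f) = h * lineL e f
    blockM h (inj₁ e) (inj₂ f) = - (h * mulFin n (transpose absD) incD e f)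
    blockM h (inj₂ e) (inj₁ f) = h * mulFin n (transpose incD) absD e f
    blockM h (inj₂ e) (inj₂ f) = - (h * signedS e f)

-- For a simple graph the Hashimoto matrix is T = A − J, where
-- A d d' = [head d = tail d'] = Σ_v [head d = v] [tail d' = v] and J is edge
-- reversal: a dart d' that follows d and returns to its tail can only be the
-- reverse of d.  Pairing with φ_e^± turns the head indicators of a vertex v into
-- the entries |D| v e and D v e, and its tail indicators into |D| v e and −D v e,
-- so Qᵀ A Q is r² times the block matrix of incidence products; and since φ_e^±
-- are ±1-eigenvectors of J, Qᵀ J Q = 2r² diag(I, −I).  The two −2I corrections
-- in L and S are exactly this reversal term.
module Submission where

open import Defs
open import Level using (Level)
open import Data.Nat using (ℕ; zero; suc)
open import Data.Fin using (Fin; zero; suc)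
open import Data.Fin.Properties using (_≟_)
open import Data.Sum using (inj₁; inj₂; swap)
open import Data.Sum.Properties using (≡-dec)
open import Data.Product using (_,_; proj₁; proj₂)
open import Data.Empty using (⊥; ⊥-elim)
open import Function using (_∘_)
open import Relation.Nullary using (yes; no)
open import Relation.Binary.PropositionalEquality as ≡ using (_≡_; _≢_)
open import Algebra.Bundles using (CommutativeRing)
import Algebra.Properties.Ring as RingProperties
import Algebra.Properties.CommutativeSemigroup as CommutativeSemigroupProperties
import Relation.Binary.Reasoning.Setoid as SetoidReasoning

module _ {n m : ℕ} (G : SimpleGraph n m) where
  open SimpleGraph G

  parallel⇒≡ : ∀ e f → tail e ≡ tail f → head e ≡ head f → e ≡ f
  parallel⇒≡ e f t h with e ≟ f
  ... | yes e≡f = e≡f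
  ... | no e≢f  = ⊥-elim (proj₁ (noMulti e f e≢f) (t , h))

  ¬antiparallel : ∀ e f → tail e ≡ head f → head e ≡ tail f → ⊥
  ¬antiparallel e f t h with e ≟ f
  ... | yes ≡.refl = noLoop e t
  ... | no e≢f     = proj₂ (noMulti e f e≢f) (t , h)

  dartHead-swap : ∀ d → dartHead G (swap d) ≡ dartTail G d
  dartHead-swap (inj₁ e) = ≡.refl
  dartHead-swap (inj₂ e) = ≡.refl

  dartTail-swap : ∀ d → dartTail G (swap d) ≡ dartHead G d
  dartTail-swap (inj₁ e) = ≡.refl
  dartTail-swap (inj₂ e) = ≡.refl

  backtrack⇒swap : ∀ d d' → dartHead G d ≡ dartTail G d' → dartHead G d' ≡ dartTail G d →
                   d' ≡ swap d
  backtrack⇒swap (inj₁ e) (inj₁ f) p q = ⊥-elim (¬antiparallel e f (≡.sym q) p)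
  backtrack⇒swap (inj₁ e) (inj₂ f) p q = ≡.cong inj₂ (parallel⇒≡ f e q (≡.sym p))
  backtrack⇒swap (inj₂ e) (inj₁ f) p q = ≡.cong inj₁ (parallel⇒≡ f e (≡.sym p) q)
  backtrack⇒swap (inj₂ e) (inj₂ f) p q = ⊥-elim (¬antiparallel e f p (≡.sym q))

module _ {c ℓ : Level} (R : CommutativeRing c ℓ) where
  open CommutativeRing R hiding (zero)
  open RingProperties ring using (-0#≈0#; -‿+-comm; -‿distribˡ-*; -‿distribʳ-*;
                                  x[y-z]≈xy-xz; ⁻¹-anti-homo‿-)
  open CommutativeSemigroupProperties +-commutativeSemigroup using (interchange)
  open SetoidReasoning setoid

  ∑ : (k : ℕ) → (Fin k → Carrier) → Carrier
  ∑ = Σ[_] R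

  x-0≈x : ∀ x → x - 0# ≈ x
  x-0≈x x = trans (+-congˡ -0#≈0#) (+-identityʳ x)

  two*x≈x+x : ∀ x → two R * x ≈ x + x
  two*x≈x+x x = trans (distribʳ x 1# 1#) (+-cong (*-identityˡ x) (*-identityˡ x))

  δ-≡ : ∀ {k} {i j : Fin k} → i ≡ j → δ R i j ≈ 1#
  δ-≡ {i = i} {j} i≡j with i ≟ j
  ... | yes _  = refl
  ... | no i≢j = ⊥-elim (i≢j i≡j)

  δ-≢ : ∀ {k} {i j : Fin k} → i ≢ j → δ R i j ≈ 0#
  δ-≢ {i = i} {j} i≢j with i ≟ j
  ... | yes i≡j = ⊥-elim (i≢j i≡j)
  ... | no _    = refl

  δ-suc : ∀ {k} (i j : Fin k) → δ R (suc i) (suc j) ≡ δ R i j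
  δ-suc i j with i ≟ j
  ... | yes _ = ≡.refl
  ... | no _  = ≡.refl

  Σ-cong : ∀ {k} {f g : Fin k → Carrier} → (∀ i → f i ≈ g i) → ∑ k f ≈ ∑ k g
  Σ-cong {zero}  f≈g = refl
  Σ-cong {suc k} f≈g = +-cong (f≈g zero) (Σ-cong (f≈g ∘ suc))

  Σ⊎-cong : ∀ {k} {f g : Dart k → Carrier} → (∀ d → f d ≈ g d) → Σ⊎ R k f ≈ Σ⊎ R k g
  Σ⊎-cong f≈g = +-cong (Σ-cong (f≈g ∘ inj₁)) (Σ-cong (f≈g ∘ inj₂))

  Σ-zero : ∀ k → ∑ k (λ _ → 0#) ≈ 0#
  Σ-zero zero    = refl
  Σ-zero (suc k) = trans (+-identityˡ _) (Σ-zero k)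

  Σ-*-negʳ : ∀ {k} (x y : Fin k → Carrier) → ∑ k (λ i → x i * - y i) ≈ - ∑ k (λ i → x i * y i)
  Σ-*-negʳ {zero}  x y = sym -0#≈0#
  Σ-*-negʳ {suc k} x y =
    trans (+-cong (sym (-‿distribʳ-* _ _)) (Σ-*-negʳ (x ∘ suc) (y ∘ suc))) (-‿+-comm _ _)

  Σ-δ : ∀ {k} (j : Fin k) (g : Fin k → Carrier) → ∑ k (λ i → δ R i j * g i) ≈ g j
  Σ-δ {suc k} zero g = begin
    1# * g zero + ∑ k (λ i → 0# * g (suc i))
      ≈⟨ +-cong (*-identityˡ _) (Σ-cong (λ i → zeroˡ (g (suc i)))) ⟩
    g zero + ∑ k (λ _ → 0#)
      ≈⟨ +-congˡ (Σ-zero k) ⟩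
    g zero + 0#
      ≈⟨ +-identityʳ _ ⟩
    g zero ∎
  Σ-δ {suc k} (suc j) g = begin
    0# * g zero + ∑ k (λ i → δ R (suc i) (suc j) * g (suc i))
      ≈⟨ +-cong (zeroˡ _) (Σ-cong (λ i → *-congʳ (reflexive (δ-suc i j)))) ⟩
    0# + ∑ k (λ i → δ R i j * g (suc i))
      ≈⟨ +-identityˡ _ ⟩
    ∑ k (λ i → δ R i j * g (suc i))
      ≈⟨ Σ-δ j (g ∘ suc) ⟩
    g (suc j) ∎

  Σ-*δ : ∀ {k} x (j : Fin k) (g : Fin k → Carrier) → ∑ k (λ i → (x * δ R i j) * g i) ≈ x * g j
  Σ-*δ {k} x j g =
    trans (Σ-cong {k} (λ i → trans (*-congʳ (*-comm x (δ R i j))) (*-assoc _ x (g i))))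
          (Σ-δ j (λ i → x * g i))

  Σ-neg*δ : ∀ {k} x (j : Fin k) (g : Fin k → Carrier) →
            ∑ k (λ i → - (x * δ R i j) * g i) ≈ - (x * g j)
  Σ-neg*δ {k} x j g =
    trans (Σ-cong {k} (λ i → *-congʳ (-‿distribˡ-* x (δ R i j))))
          (trans (Σ-*δ (- x) j g) (sym (-‿distribˡ-* x (g j))))

  module _ {m : ℕ} where

    -- φ⟨ a ⟩ g is √2 ⟨φ_a, g⟩: the column a of Qmat r is r times this functional.
    φ⟨_⟩ : Dart m → (Dart m → Carrier) → Carrier
    φ⟨ inj₁ e ⟩ g = g (inj₁ e) + g (inj₂ e)
    φ⟨ inj₂ e ⟩ g = g (inj₁ e) - g (inj₂ e)

    φ-cong : ∀ a {g h : Dart m → Carrier} → (∀ d → g d ≈ h d) → φ⟨ a ⟩ g ≈ φ⟨ a ⟩ h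
    φ-cong (inj₁ e) g≈h = +-cong (g≈h _) (g≈h _)
    φ-cong (inj₂ e) g≈h = +-cong (g≈h _) (-‿cong (g≈h _))

    φ-zero : ∀ a → φ⟨ a ⟩ (λ _ → 0#) ≈ 0#
    φ-zero (inj₁ e) = +-identityˡ 0#
    φ-zero (inj₂ e) = -‿inverseʳ 0#

    φ-+ : ∀ a g h → φ⟨ a ⟩ (λ d → g d + h d) ≈ φ⟨ a ⟩ g + φ⟨ a ⟩ h
    φ-+ (inj₁ e) g h = interchange _ _ _ _
    φ-+ (inj₂ e) g h = trans (+-congˡ (sym (-‿+-comm _ _))) (interchange _ _ _ _)

    φ-neg : ∀ a g → φ⟨ a ⟩ (λ d → - g d) ≈ - φ⟨ a ⟩ g
    φ-neg (inj₁ e) g = -‿+-comm _ _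
    φ-neg (inj₂ e) g = -‿+-comm _ _

    φ-- : ∀ a g h → φ⟨ a ⟩ (λ d → g d - h d) ≈ φ⟨ a ⟩ g - φ⟨ a ⟩ h
    φ-- a g h = trans (φ-+ a g (λ d → - h d)) (+-congˡ (φ-neg a h))

    φ-*ˡ : ∀ a x g → φ⟨ a ⟩ (λ d → x * g d) ≈ x * φ⟨ a ⟩ g
    φ-*ˡ (inj₁ e) x g = sym (distribˡ x _ _)
    φ-*ˡ (inj₂ e) x g = sym (x[y-z]≈xy-xz x _ _)

    φ-*ʳ : ∀ a x g → φ⟨ a ⟩ (λ d → g d * x) ≈ φ⟨ a ⟩ g * x
    φ-*ʳ a x g = trans (φ-cong a (λ d → *-comm (g d) x)) (trans (φ-*ˡ a x g) (*-comm x _))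

    φ-Σ : ∀ {k} a (F : Fin k → Dart m → Carrier) →
          φ⟨ a ⟩ (λ d → ∑ k (λ v → F v d)) ≈ ∑ k (λ v → φ⟨ a ⟩ (F v))
    φ-Σ {zero}  a F = φ-zero a
    φ-Σ {suc k} a F = trans (φ-+ a _ _) (+-congˡ (φ-Σ a (F ∘ suc)))

    compress : (Dart m → Dart m → Carrier) → Dart m → Dart m → Carrier
    compress M a b = φ⟨ b ⟩ (λ d' → φ⟨ a ⟩ (λ d → M d d'))

    compress-cong : ∀ {M N : Dart m → Dart m → Carrier} → (∀ d d' → M d d' ≈ N d d') →
                    ∀ a b → compress M a b ≈ compress N a b
    compress-cong M≈N a b = φ-cong b (λ d' → φ-cong a (λ d → M≈N d d'))

    compress-- : ∀ M N a b →
                 compress (λ d d' → M d d' - N d d') a b ≈ compress M a b - compress N a b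
    compress-- M N a b = trans (φ-cong b (λ d' → φ-- a _ _)) (φ-- b _ _)

    compress-Σ* : ∀ {k} (h t : Fin k → Dart m → Carrier) a b →
                  compress (λ d d' → ∑ k (λ v → h v d * t v d')) a b
                    ≈ ∑ k (λ v → φ⟨ a ⟩ (h v) * φ⟨ b ⟩ (t v))
    compress-Σ* {k} h t a b = begin
      φ⟨ b ⟩ (λ d' → φ⟨ a ⟩ (λ d → ∑ k (λ v → h v d * t v d')))
        ≈⟨ φ-cong b (λ d' → trans (φ-Σ {k} a (λ v d → h v d * t v d'))
                                  (Σ-cong (λ v → φ-*ʳ a (t v d') (h v)))) ⟩
      φ⟨ b ⟩ (λ d' → ∑ k (λ v → φ⟨ a ⟩ (h v) * t v d'))
        ≈⟨ φ-Σ {k} b (λ v d' → φ⟨ a ⟩ (h v) * t v d') ⟩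
      ∑ k (λ v → φ⟨ b ⟩ (λ d' → φ⟨ a ⟩ (h v) * t v d'))
        ≈⟨ Σ-cong (λ v → φ-*ˡ b (φ⟨ a ⟩ (h v)) (t v)) ⟩
      ∑ k (λ v → φ⟨ a ⟩ (h v) * φ⟨ b ⟩ (t v)) ∎

    reversal : Dart m → Dart m → Carrier
    reversal (inj₁ e) (inj₂ f) = δ R e f
    reversal (inj₂ e) (inj₁ f) = δ R e f
    reversal (inj₁ e) (inj₁ f) = 0#
    reversal (inj₂ e) (inj₂ f) = 0#

    reversal-swap : ∀ d → reversal d (swap d) ≈ 1#
    reversal-swap (inj₁ e) = δ-≡ {i = e} ≡.refl
    reversal-swap (inj₂ e) = δ-≡ {i = e} ≡.refl

    reversal-≢swap : ∀ d d' → d' ≢ swap d → reversal d d' ≈ 0#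
    reversal-≢swap (inj₁ e) (inj₁ f) _  = refl
    reversal-≢swap (inj₁ e) (inj₂ f) ne = δ-≢ (λ e≡f → ne (≡.cong inj₂ (≡.sym e≡f)))
    reversal-≢swap (inj₂ e) (inj₁ f) ne = δ-≢ (λ e≡f → ne (≡.cong inj₁ (≡.sym e≡f)))
    reversal-≢swap (inj₂ e) (inj₂ f) _  = refl

    reversalBlock : Dart m → Dart m → Carrier
    reversalBlock (inj₁ e) (inj₁ f) = two R * δ R e f
    reversalBlock (inj₂ e) (inj₂ f) = - (two R * δ R e f)
    reversalBlock (inj₁ e) (inj₂ f) = 0#
    reversalBlock (inj₂ e) (inj₁ f) = 0#

    compress-reversal : ∀ a b → compress reversal a b ≈ reversalBlock a b
    compress-reversal (inj₁ e) (inj₁ f) =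
      trans (+-cong (+-identityˡ _) (+-identityʳ _)) (sym (two*x≈x+x _))
    compress-reversal (inj₁ e) (inj₂ f) =
      trans (+-cong (+-identityˡ _) (-‿cong (+-identityʳ _))) (-‿inverseʳ _)
    compress-reversal (inj₂ e) (inj₁ f) =
      trans (+-cong (+-identityˡ _) (x-0≈x _)) (-‿inverseˡ _)
    compress-reversal (inj₂ e) (inj₂ f) =
      trans (+-cong (+-identityˡ _) (-‿cong (x-0≈x _)))
            (trans (-‿+-comm _ _) (-‿cong (sym (two*x≈x+x _))))

  module _ {n m : ℕ} (G : SimpleGraph n m) where
    open SimpleGraph G

    hashimoto-backtracking : ∀ d d' → dartHead G d' ≡ dartTail G d → hashimoto R G d d' ≈ 0#
    hashimoto-backtracking d d' b with dartHead G d ≟ dartTail G d' | dartHead G d' ≟ dartTail G d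
    ... | yes _ | no nb = ⊥-elim (nb b)
    ... | yes _ | yes _ = refl
    ... | no _  | _     = refl

    hashimoto-≢swap : ∀ d d' → d' ≢ swap d →
                      hashimoto R G d d' ≈ δ R (dartHead G d) (dartTail G d')
    hashimoto-≢swap d d' ne with dartHead G d ≟ dartTail G d' | dartHead G d' ≟ dartTail G d
    ... | yes c | yes b = ⊥-elim (ne (backtrack⇒swap G d d' c b))
    ... | yes _ | no _  = refl
    ... | no _  | _     = refl

    hashimoto≈consecutive-reversal : ∀ d d' →
      hashimoto R G d d' ≈ δ R (dartHead G d) (dartTail G d') - reversal d d'
    hashimoto≈consecutive-reversal d d' with ≡-dec _≟_ _≟_ d' (swap d)
    ... | yes ≡.refl = begin
      hashimoto R G d (swap d)
        ≈⟨ hashimoto-backtracking d _ (dartHead-swap G d) ⟩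
      0#
        ≈⟨ -‿inverseʳ 1# ⟨
      1# - 1#
        ≈⟨ +-cong (δ-≡ (≡.sym (dartTail-swap G d))) (-‿cong (reversal-swap d)) ⟨
      δ R (dartHead G d) (dartTail G (swap d)) - reversal d (swap d) ∎
    ... | no ne = begin
      hashimoto R G d d'
        ≈⟨ hashimoto-≢swap d d' ne ⟩
      δ R (dartHead G d) (dartTail G d')
        ≈⟨ x-0≈x _ ⟨
      δ R (dartHead G d) (dartTail G d') - 0#
        ≈⟨ +-congˡ (-‿cong (reversal-≢swap d d' ne)) ⟨
      δ R (dartHead G d) (dartTail G d') - reversal d d' ∎

    absD≈δ+δ : ∀ v e → absD R G v e ≈ δ R v (head e) + δ R v (tail e)
    absD≈δ+δ v e with v ≟ head e | v ≟ tail e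
    ... | yes p | yes q = ⊥-elim (noLoop e (≡.trans (≡.sym q) p))
    ... | yes _ | no _  = sym (+-identityʳ 1#)
    ... | no _  | yes _ = sym (+-identityˡ 1#)
    ... | no _  | no _  = sym (+-identityˡ 0#)

    incD≈δ-δ : ∀ v e → incD R G v e ≈ δ R v (head e) - δ R v (tail e)
    incD≈δ-δ v e with v ≟ head e | v ≟ tail e
    ... | yes p | yes q = ⊥-elim (noLoop e (≡.trans (≡.sym q) p))
    ... | yes _ | no _  = sym (x-0≈x 1#)
    ... | no _  | yes _ = sym (+-identityˡ (- 1#))
    ... | no _  | no _  = sym (x-0≈x 0#)

    headIncidence : Dart m → Fin n → Carrier
    headIncidence (inj₁ e) v = absD R G v e
    headIncidence (inj₂ e) v = incD R G v e

    tailIncidence : Dart m → Fin n → Carrier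
    tailIncidence (inj₁ e) v = absD R G v e
    tailIncidence (inj₂ e) v = - incD R G v e

    φ-heads : ∀ a v → φ⟨ a ⟩ (λ d → δ R v (dartHead G d)) ≈ headIncidence a v
    φ-heads (inj₁ e) v = sym (absD≈δ+δ v e)
    φ-heads (inj₂ e) v = sym (incD≈δ-δ v e)

    φ-tails : ∀ a v → φ⟨ a ⟩ (λ d → δ R v (dartTail G d)) ≈ tailIncidence a v
    φ-tails (inj₁ e) v = trans (+-comm _ _) (sym (absD≈δ+δ v e))
    φ-tails (inj₂ e) v = trans (sym (⁻¹-anti-homo‿- _ _)) (-‿cong (sym (incD≈δ-δ v e)))

    compress-consecutive : ∀ a b →
      compress (λ d d' → δ R (dartHead G d) (dartTail G d')) a b
        ≈ ∑ n (λ v → headIncidence a v * tailIncidence b v)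
    compress-consecutive a b = begin
      compress (λ d d' → δ R (dartHead G d) (dartTail G d')) a b
        ≈⟨ compress-cong (λ d d' → Σ-δ (dartHead G d) (λ v → δ R v (dartTail G d'))) a b ⟨
      compress (λ d d' → ∑ n (λ v → δ R v (dartHead G d) * δ R v (dartTail G d'))) a b
        ≈⟨ compress-Σ* {k = n} (λ v d → δ R v (dartHead G d)) (λ v d → δ R v (dartTail G d)) a b ⟩
      ∑ n (λ v → φ⟨ a ⟩ (λ d → δ R v (dartHead G d)) * φ⟨ b ⟩ (λ d → δ R v (dartTail G d)))
        ≈⟨ Σ-cong (λ v → *-cong (φ-heads a v) (φ-tails b v)) ⟩
      ∑ n (λ v → headIncidence a v * tailIncidence b v) ∎

    block : Dart m → Dart m → Carrier
    block (inj₁ e) (inj₁ f) = lineL R G e f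
    block (inj₁ e) (inj₂ f) = - mulFin R n (transpose R (absD R G)) (incD R G) e f
    block (inj₂ e) (inj₁ f) = mulFin R n (transpose R (incD R G)) (absD R G) e f
    block (inj₂ e) (inj₂ f) = - signedS R G e f

    incidence-reversal≈block : ∀ a b →
      ∑ n (λ v → headIncidence a v * tailIncidence b v) - reversalBlock a b ≈ block a b
    incidence-reversal≈block (inj₁ e) (inj₁ f) = refl
    incidence-reversal≈block (inj₁ e) (inj₂ f) =
      trans (x-0≈x _) (Σ-*-negʳ (λ v → absD R G v e) (λ v → incD R G v f))
    incidence-reversal≈block (inj₂ e) (inj₁ f) = x-0≈x _
    incidence-reversal≈block (inj₂ e) (inj₂ f) =
      trans (+-congʳ (Σ-*-negʳ (λ v → incD R G v e) (λ v → incD R G v f))) (-‿+-comm _ _)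

    compress-hashimoto : ∀ a b → compress (hashimoto R G) a b ≈ block a b
    compress-hashimoto a b = begin
      compress (hashimoto R G) a b
        ≈⟨ compress-cong hashimoto≈consecutive-reversal a b ⟩
      compress (λ d d' → δ R (dartHead G d) (dartTail G d') - reversal d d') a b
        ≈⟨ compress-- _ reversal a b ⟩
      compress (λ d d' → δ R (dartHead G d) (dartTail G d')) a b - compress reversal a b
        ≈⟨ +-cong (compress-consecutive a b) (-‿cong (compress-reversal a b)) ⟩
      ∑ n (λ v → headIncidence a v * tailIncidence b v) - reversalBlock a b
        ≈⟨ incidence-reversal≈block a b ⟩
      block a b ∎

    Q-column : ∀ r a g → Σ⊎ R m (λ d → Qmat R G r d a * g d) ≈ r * φ⟨ a ⟩ g
    Q-column r (inj₁ e) g =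
      trans (+-cong (Σ-*δ r e (g ∘ inj₁)) (Σ-*δ r e (g ∘ inj₂))) (sym (distribˡ r _ _))
    Q-column r (inj₂ e) g =
      trans (+-cong (Σ-*δ r e (g ∘ inj₁)) (Σ-neg*δ r e (g ∘ inj₂))) (sym (x[y-z]≈xy-xz r _ _))

    Qᵀ-M-Q≈r²compress : ∀ r M a b →
      mulDart R m (mulDart R m (transpose R (Qmat R G r)) M) (Qmat R G r) a b
        ≈ (r * r) * compress M a b
    Qᵀ-M-Q≈r²compress r M a b = begin
      Σ⊎ R m (λ d' → Σ⊎ R m (λ d → Q d a * M d d') * Q d' b)
        ≈⟨ Σ⊎-cong {m} (λ d' → *-comm (Σ⊎ R m (λ d → Q d a * M d d')) (Q d' b)) ⟩
      Σ⊎ R m (λ d' → Q d' b * Σ⊎ R m (λ d → Q d a * M d d'))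
        ≈⟨ Q-column r b _ ⟩
      r * φ⟨ b ⟩ (λ d' → Σ⊎ R m (λ d → Q d a * M d d'))
        ≈⟨ *-congˡ (φ-cong b (λ d' → Q-column r a (λ d → M d d'))) ⟩
      r * φ⟨ b ⟩ (λ d' → r * φ⟨ a ⟩ (λ d → M d d'))
        ≈⟨ *-congˡ (φ-*ˡ b r _) ⟩
      r * (r * compress M a b)
        ≈⟨ *-assoc r r _ ⟨
      (r * r) * compress M a b ∎
      where
      Q : Dart m → Dart m → Carrier
      Q = Qmat R G r

    blockM≈*block : ∀ h a b → blockM R G h a b ≈ h * block a b
    blockM≈*block h (inj₁ e) (inj₁ f) = refl
    blockM≈*block h (inj₁ e) (inj₂ f) = -‿distribʳ-* h _
    blockM≈*block h (inj₂ e) (inj₁ f) = refl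
    blockM≈*block h (inj₂ e) (inj₂ f) = -‿distribʳ-* h _

theorem4p1 : ∀ {c ℓ : Level} (R : CommutativeRing c ℓ) → let open CommutativeRing R in
    (r : Carrier) → r * r + r * r ≈ 1# →
    ∀ {n m : ℕ} (G : SimpleGraph n m) →
    ∀ a b → mulDart R m (mulDart R m (transpose R (Qmat R G r)) (hashimoto R G)) (Qmat R G r) a b
              ≈ blockM R G (r * r) a b
theorem4p1 R r _ G a b = begin
  mulDart R _ (mulDart R _ (transpose R (Qmat R G r)) (hashimoto R G)) (Qmat R G r) a b
    ≈⟨ Qᵀ-M-Q≈r²compress R G r (hashimoto R G) a b ⟩
  (r * r) * compress R (hashimoto R G) a b
    ≈⟨ *-congˡ (compress-hashimoto R G a b) ⟩
  (r * r) * block R G a b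
    ≈⟨ blockM≈*block R G (r * r) a b ⟨
  blockM R G (r * r) a b ∎
  where
  open CommutativeRing R
  open SetoidReasoning setoid
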